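{- For every $k\ge 2$, let $A_k=S_{k-2}$ and $B_k=\widehat{A_k}$. Then none of $A_kA_k$, $A_kB_k$, $B_kA_k$ has an internal occurrence of $A_k$. Hence the number of occurrences of $A_k$ in $S_k = A_kB_kA_kA_k$ is $3$.
   Context: Strings are over the binary alphabet $\{a,b\}$. For $c\in\{a,b\}$, $\overline{c}$ is the other letter; for a nonempty string $w$, $\widehat{w} = w[1..|w|-1]\cdot\overline{w[|w|]}$. The period-doubling sequences are $S_0=a$ and $S_k = S_{k-1}\widehat{S_{k-1}}$ for $k\ge 1$ (equivalently $S_k=\phi(S_{k-1})$ with $\phi(a)=ab$, $\phi(b)=aa$). A string $w$ has an internal occurrence of $y$ if $y$ occurs in $w$ at a position such that this occurrence is neither a prefix nor a suffix of $w$. -}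

module Defs where

open import Data.Nat using (ℕ; zero; suc; _+_; _∸_)
open import Data.List using (List; []; _∷_; _++_; length)
open import Data.Product using (Σ; ∃; _×_; _,_)
open import Relation.Binary.PropositionalEquality using (_≡_)
open import Relation.Nullary using (¬_; Dec; yes; no; does)
open import Data.Bool using (Bool; true; false; _∧_; if_then_else_)
open import Relation.Binary using (DecidableEquality)

data Letter : Set where
  a b : Letter

_≟L_ : DecidableEquality Letter
a ≟L a = yes _≡_.refl
a ≟L b = no (λ ())
b ≟L a = no (λ ())
b ≟L b = yes _≡_.refl

Str : Set
Str = List Letter

flip : Letter → Letter
flip a = b
flip b = a

-- ŵ : flip the last letter (the empty string is left unchanged; only used on nonempty strings)
hat : Str → Str
hat [] = []
hat (c ∷ []) = flip c ∷ []
hat (c ∷ d ∷ w) = c ∷ hat (d ∷ w)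

S : ℕ → Str
S zero = a ∷ []
S (suc k) = S k ++ hat (S k)

HasInternalOcc : Str → Str → Set
HasInternalOcc y w = Σ Str λ u → Σ Str λ v → (w ≡ u ++ y ++ v) × (¬ u ≡ []) × (¬ v ≡ [])

isPrefix : Str → Str → Bool
isPrefix [] _ = true
isPrefix (_ ∷ _) [] = false
isPrefix (c ∷ y) (d ∷ w) = (does (c ≟L d)) ∧ isPrefix y w

countOcc : Str → Str → ℕ
countOcc y [] = if isPrefix y [] then 1 else 0
countOcc y (d ∷ w) = (if isPrefix y (d ∷ w) then 1 else 0) + countOcc y w

-- S n is the image φⁿ(a) of the period-doubling morphism φ, and S (2 + n) = φⁿ(abaa).
-- The key fact is synchronisation: in φ(W) every even position carries a, so an
-- occurrence of φ(aX) = ab… can only start at an even position, i.e. over a letter of W,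
-- and it then spells φ of a factor aX of W. Iterating, every occurrence of φⁿ(a) in φⁿ(w)
-- is the image of an occurrence of the letter a in w. So the occurrences of S n in
-- φⁿ(xy) are not internal, and there are exactly three of them in φⁿ(abaa).
module Submission where

open import Defs
open import Data.Nat using (ℕ; zero; suc; _+_; _≥_; _∸_; s≤s)
open import Data.List using ([]; _∷_; _++_; [_]; length; filter)
open import Data.List.Properties
  using (++-assoc; ++-conicalˡ; ++-identityʳ-unique; ∷-injectiveˡ; ∷-injectiveʳ)
open import Data.Product using (_×_; _,_; ∃; ∃₂)
open import Data.Sum using (_⊎_; inj₁; inj₂)
open import Data.Bool using (true; false; if_then_else_)
open import Data.Empty using (⊥-elim)
open import Relation.Nullary using (¬_; yes)
open import Relation.Binary.PropositionalEquality
  using (_≡_; _≢_; refl; sym; trans; cong; cong₂; subst; subst₂; module ≡-Reasoning)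
open ≡-Reasoning

flip-injective : ∀ {c d} → flip c ≡ flip d → c ≡ d
flip-injective {a} {a} _ = refl
flip-injective {b} {b} _ = refl

φ : Str → Str
φ [] = []
φ (c ∷ w) = a ∷ flip c ∷ φ w

-- Iterated on the inside, so that φ^ (2 + n) [ a ] computes to φ^ n (a ∷ b ∷ a ∷ a ∷ []).
φ^ : ℕ → Str → Str
φ^ zero w = w
φ^ (suc n) w = φ^ n (φ w)

φ-++ : ∀ x y → φ (x ++ y) ≡ φ x ++ φ y
φ-++ [] y = refl
φ-++ (c ∷ x) y = cong (λ z → a ∷ flip c ∷ z) (φ-++ x y)

φ^-++ : ∀ n x y → φ^ n (x ++ y) ≡ φ^ n x ++ φ^ n y
φ^-++ zero x y = refl
φ^-++ (suc n) x y = trans (cong (φ^ n) (φ-++ x y)) (φ^-++ n (φ x) (φ y))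

φ^-∷ : ∀ n c w → φ^ n (c ∷ w) ≡ φ^ n [ c ] ++ φ^ n w
φ^-∷ n c w = φ^-++ n [ c ] w

φ^-[] : ∀ n → φ^ n [] ≡ []
φ^-[] zero = refl
φ^-[] (suc n) = φ^-[] n

φ^-φ : ∀ n w → φ^ n (φ w) ≡ φ (φ^ n w)
φ^-φ zero w = refl
φ^-φ (suc n) w = φ^-φ n (φ w)

φ-hat : ∀ w → φ (hat w) ≡ hat (φ w)
φ-hat [] = refl
φ-hat (c ∷ []) = refl
φ-hat (c ∷ d ∷ w) = cong (λ z → a ∷ flip c ∷ z) (φ-hat (d ∷ w))

φ^-b : ∀ n → φ^ n [ b ] ≡ hat (φ^ n [ a ])
φ^-b zero = refl
φ^-b (suc n) = begin
  φ^ n (φ [ b ])        ≡⟨ φ^-φ n [ b ] ⟩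
  φ (φ^ n [ b ])        ≡⟨ cong φ (φ^-b n) ⟩
  φ (hat (φ^ n [ a ]))  ≡⟨ φ-hat (φ^ n [ a ]) ⟩
  hat (φ (φ^ n [ a ]))  ≡⟨ cong hat (φ^-φ n [ a ]) ⟨
  hat (φ^ n (φ [ a ]))  ∎

S≡φ^ : ∀ n → S n ≡ φ^ n [ a ]
S≡φ^ zero = refl
S≡φ^ (suc n) = begin
  S n ++ hat (S n)                ≡⟨ cong (λ A → A ++ hat A) (S≡φ^ n) ⟩
  φ^ n [ a ] ++ hat (φ^ n [ a ])  ≡⟨ cong (φ^ n [ a ] ++_) (φ^-b n) ⟨
  φ^ n [ a ] ++ φ^ n [ b ]        ≡⟨ φ^-∷ n a [ b ] ⟨
  φ^ n (a ∷ b ∷ [])               ∎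

φ^-[a]-head : ∀ n → ∃ λ X → φ^ n [ a ] ≡ a ∷ X
φ^-[a]-head zero = [] , refl
φ^-[a]-head (suc n) with X , eq ← φ^-[a]-head n =
  X ++ φ^ n [ b ] , trans (φ^-∷ n a [ b ]) (cong (_++ φ^ n [ b ]) eq)

φ^-[c]-nonempty : ∀ n c → ∃₂ λ x X → φ^ n [ c ] ≡ x ∷ X
φ^-[c]-nonempty zero c = c , [] , refl
φ^-[c]-nonempty (suc n) c with X , eq ← φ^-[a]-head n =
  a , X ++ φ^ n [ flip c ] , trans (φ^-∷ n a [ flip c ]) (cong (_++ φ^ n [ flip c ]) eq)

φ^-≡[] : ∀ n w → φ^ n w ≡ [] → w ≡ []
φ^-≡[] n [] _ = refl
φ^-≡[] n (c ∷ w) eq with x , X , c≡ ← φ^-[c]-nonempty n c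
  with () ← trans (sym (cong (_++ φ^ n w) c≡)) (trans (sym (φ^-∷ n c w)) eq)

φ-cancelˡ : ∀ W Y v → φ W ≡ φ Y ++ v → ∃ λ W₂ → W ≡ Y ++ W₂ × v ≡ φ W₂
φ-cancelˡ W [] v eq = W , refl , sym eq
φ-cancelˡ (d ∷ W) (c ∷ Y) v eq
  with refl ← flip-injective (∷-injectiveˡ (∷-injectiveʳ eq))
  with W₂ , W≡ , v≡ ← φ-cancelˡ W Y v (∷-injectiveʳ (∷-injectiveʳ eq)) =
  W₂ , cong (c ∷_) W≡ , v≡

φ-desubstitute : ∀ W u X v → φ W ≡ u ++ φ (a ∷ X) ++ v →
  ∃₂ λ W₁ W₂ → W ≡ W₁ ++ (a ∷ X) ++ W₂ × u ≡ φ W₁ × v ≡ φ W₂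
φ-desubstitute W [] X v eq with W₂ , W≡ , v≡ ← φ-cancelˡ W (a ∷ X) v eq =
  [] , W₂ , W≡ , refl , v≡
-- At an odd offset the occurrence would need b where φ W has a.
φ-desubstitute (c ∷ e ∷ W) (d ∷ []) X v ()
φ-desubstitute (c ∷ W) (d ∷ d′ ∷ u) X v eq
  with refl ← ∷-injectiveˡ eq
  with refl ← ∷-injectiveˡ (∷-injectiveʳ eq)
  with W₁ , W₂ , W≡ , u≡ , v≡ ← φ-desubstitute W u X v (∷-injectiveʳ (∷-injectiveʳ eq)) =
  c ∷ W₁ , W₂ , cong (c ∷_) W≡ , cong (λ z → a ∷ flip c ∷ z) u≡ , v≡

φ^-synchronise : ∀ n w u v → φ^ n w ≡ u ++ φ^ n [ a ] ++ v →
  ∃₂ λ w₁ w₂ → w ≡ w₁ ++ a ∷ w₂ × u ≡ φ^ n w₁ × v ≡ φ^ n w₂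
φ^-synchronise zero w u v eq = u , v , eq , refl , refl
φ^-synchronise (suc n) w u v eq
  with X , A≡ ← φ^-[a]-head n
  with W₁ , W₂ , W≡ , u≡ , v≡ ← φ-desubstitute (φ^ n w) u X v (begin
    φ (φ^ n w)                ≡⟨ φ^-φ n w ⟨
    φ^ n (φ w)                ≡⟨ eq ⟩
    u ++ φ^ n (φ [ a ]) ++ v  ≡⟨ cong (λ Z → u ++ Z ++ v) (trans (φ^-φ n [ a ]) (cong φ A≡)) ⟩
    u ++ φ (a ∷ X) ++ v       ∎)
  with w₁ , w₂ , w≡ , W₁≡ , W₂≡ ←
         φ^-synchronise n w W₁ W₂ (subst (λ A → φ^ n w ≡ W₁ ++ A ++ W₂) (sym A≡) W≡) =
  w₁ , w₂ , w≡ , image u≡ W₁≡ , image v≡ W₂≡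
  where
  image : ∀ {x X x′} → x ≡ φ X → X ≡ φ^ n x′ → x ≡ φ^ (suc n) x′
  image {x′ = x′} x≡ X≡ = trans x≡ (trans (cong φ X≡) (sym (φ^-φ n x′)))

pair-split : ∀ {x y c : Letter} w₁ w₂ → x ∷ y ∷ [] ≡ w₁ ++ c ∷ w₂ → w₁ ≡ [] ⊎ w₂ ≡ []
pair-split [] _ _ = inj₁ refl
pair-split (_ ∷ []) [] _ = inj₂ refl
pair-split (_ ∷ []) (_ ∷ _) ()
pair-split (_ ∷ _ ∷ []) _ ()
pair-split (_ ∷ _ ∷ _ ∷ _) _ ()

φ^-pair-noInternal : ∀ n x y → ¬ HasInternalOcc (φ^ n [ a ]) (φ^ n [ x ] ++ φ^ n [ y ])
φ^-pair-noInternal n x y (u , v , eq , u≢[] , v≢[])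
  with w₁ , w₂ , xy≡ , u≡ , v≡ ← φ^-synchronise n (x ∷ y ∷ []) u v (trans (φ^-∷ n x [ y ]) eq)
  with pair-split w₁ w₂ xy≡
... | inj₁ refl = u≢[] (trans u≡ (φ^-[] n))
... | inj₂ refl = v≢[] (trans v≡ (φ^-[] n))

isPrefix-++ : ∀ y v → isPrefix y (y ++ v) ≡ true
isPrefix-++ [] v = refl
isPrefix-++ (a ∷ y) v = isPrefix-++ y v
isPrefix-++ (b ∷ y) v = isPrefix-++ y v

isPrefix⇒++ : ∀ y w → isPrefix y w ≡ true → ∃ λ v → w ≡ y ++ v
isPrefix⇒++ [] w _ = w , refl
isPrefix⇒++ (c ∷ y) (d ∷ w) eq with c ≟L d
... | yes refl with v , w≡ ← isPrefix⇒++ y w eq = v , cong (c ∷_) w≡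

NoOccurrenceStartsIn : Str → Str → Str → Set
NoOccurrenceStartsIn y X T = ∀ p q v → X ≡ p ++ q → q ≢ [] → q ++ T ≢ y ++ v

countOcc-++-skip : ∀ y X T → NoOccurrenceStartsIn y X T → countOcc y (X ++ T) ≡ countOcc y T
countOcc-++-skip y [] T _ = refl
countOcc-++-skip y (c ∷ X) T noOcc with isPrefix y (c ∷ X ++ T) in prefix
... | true with v , eq ← isPrefix⇒++ y (c ∷ X ++ T) prefix =
  ⊥-elim (noOcc [] (c ∷ X) v refl (λ ()) eq)
... | false = countOcc-++-skip y X T (λ p q v X≡ → noOcc (c ∷ p) q v (cong (c ∷_) X≡))

++-prefix-antisym : ∀ (p q X s : Str) → p ≡ X ++ s → X ≡ p ++ q → q ≡ []
++-prefix-antisym p q X s p≡ X≡ = ++-conicalˡ q s (++-identityʳ-unique p (begin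
  p              ≡⟨ p≡ ⟩
  X ++ s         ≡⟨ cong (_++ s) X≡ ⟩
  (p ++ q) ++ s  ≡⟨ ++-assoc p q s ⟩
  p ++ q ++ s    ∎))

φ^-noOccurrenceInsideBlock : ∀ n c w x X → φ^ n [ c ] ≡ x ∷ X →
  NoOccurrenceStartsIn (φ^ n [ a ]) X (φ^ n w)
φ^-noOccurrenceInsideBlock n c w x X c≡ p q v X≡ q≢[] occ
  with φ^-synchronise n (c ∷ w) (x ∷ p) v (begin
    φ^ n (c ∷ w)                ≡⟨ φ^-∷ n c w ⟩
    φ^ n [ c ] ++ φ^ n w        ≡⟨ cong (_++ φ^ n w) (trans c≡ (cong (x ∷_) X≡)) ⟩
    x ∷ (p ++ q) ++ φ^ n w      ≡⟨ cong (x ∷_) (++-assoc p q (φ^ n w)) ⟩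
    x ∷ p ++ q ++ φ^ n w        ≡⟨ cong (λ z → x ∷ p ++ z) occ ⟩
    x ∷ p ++ φ^ n [ a ] ++ v    ∎)
... | [] , _ , _ , xp≡ , _ with () ← trans xp≡ (φ^-[] n)
... | d ∷ w₁ , _ , cw≡ , xp≡ , _ with refl ← ∷-injectiveˡ cw≡ =
  q≢[] (++-prefix-antisym p q X (φ^ n w₁)
    (∷-injectiveʳ (trans xp≡ (trans (φ^-∷ n c w₁) (cong (_++ φ^ n w₁) c≡)))) X≡)

isPrefix-φ^-a∷ : ∀ n w → isPrefix (φ^ n [ a ]) (φ^ n (a ∷ w)) ≡ true
isPrefix-φ^-a∷ n w =
  subst (λ z → isPrefix (φ^ n [ a ]) z ≡ true) (sym (φ^-∷ n a w)) (isPrefix-++ (φ^ n [ a ]) (φ^ n w))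

isPrefix-φ^-b∷ : ∀ n w → isPrefix (φ^ n [ a ]) (φ^ n (b ∷ w)) ≡ false
isPrefix-φ^-b∷ n w with isPrefix (φ^ n [ a ]) (φ^ n (b ∷ w)) in prefix
... | false = refl
... | true with v , occ ← isPrefix⇒++ (φ^ n [ a ]) (φ^ n (b ∷ w)) prefix
  with w₁ , _ , bw≡ , []≡ , _ ← φ^-synchronise n (b ∷ w) [] v occ
  with refl ← φ^-≡[] n w₁ (sym []≡)
  with () ← ∷-injectiveˡ bw≡

countOcc-φ^-∷ : ∀ n c w → countOcc (φ^ n [ a ]) (φ^ n (c ∷ w))
  ≡ (if isPrefix (φ^ n [ a ]) (φ^ n (c ∷ w)) then 1 else 0) + countOcc (φ^ n [ a ]) (φ^ n w)
countOcc-φ^-∷ n c w with x , X , c≡ ← φ^-[c]-nonempty n c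
  rewrite φ^-∷ n c w | c≡
        | countOcc-++-skip (φ^ n [ a ]) X (φ^ n w) (φ^-noOccurrenceInsideBlock n c w x X c≡) = refl

countOcc-φ^ : ∀ n w → countOcc (φ^ n [ a ]) (φ^ n w) ≡ length (filter (_≟L a) w)
countOcc-φ^ n [] with X , A≡ ← φ^-[a]-head n = cong₂ countOcc A≡ (φ^-[] n)
countOcc-φ^ n (a ∷ w) rewrite countOcc-φ^-∷ n a w | isPrefix-φ^-a∷ n w | countOcc-φ^ n w = refl
countOcc-φ^ n (b ∷ w) rewrite countOcc-φ^-∷ n b w | isPrefix-φ^-b∷ n w | countOcc-φ^ n w = refl

φ^-abaa : ∀ n → let A = φ^ n [ a ] in φ^ n (a ∷ b ∷ a ∷ a ∷ []) ≡ A ++ hat A ++ A ++ A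
φ^-abaa n = begin
  φ^ n (a ∷ b ∷ a ∷ [ a ])                 ≡⟨ φ^-∷ n a _ ⟩
  A ++ φ^ n (b ∷ a ∷ [ a ])                ≡⟨ cong (A ++_) (φ^-∷ n b _) ⟩
  A ++ φ^ n [ b ] ++ φ^ n (a ∷ [ a ])      ≡⟨ cong (λ B → A ++ B ++ φ^ n (a ∷ [ a ])) (φ^-b n) ⟩
  A ++ hat A ++ φ^ n (a ∷ [ a ])           ≡⟨ cong (λ z → A ++ hat A ++ z) (φ^-∷ n a [ a ]) ⟩
  A ++ hat A ++ A ++ A                     ∎
  where A = φ^ n [ a ]

lemma4 : (k : ℕ) → k ≥ 2 →
    (¬ HasInternalOcc (S (k ∸ 2)) (S (k ∸ 2) ++ S (k ∸ 2)))
    × (¬ HasInternalOcc (S (k ∸ 2)) (S (k ∸ 2) ++ hat (S (k ∸ 2))))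
    × (¬ HasInternalOcc (S (k ∸ 2)) (hat (S (k ∸ 2)) ++ S (k ∸ 2)))
    × (S k ≡ S (k ∸ 2) ++ hat (S (k ∸ 2)) ++ S (k ∸ 2) ++ S (k ∸ 2))
    × (countOcc (S (k ∸ 2)) (S k) ≡ 3)
lemma4 (suc zero) (s≤s ())
lemma4 (suc (suc n)) _ = subst₂ Claim (sym (S≡φ^ n)) (sym (S≡φ^ (2 + n)))
  ( φ^-pair-noInternal n a a
  , subst (λ B → ¬ HasInternalOcc A (A ++ B)) (φ^-b n) (φ^-pair-noInternal n a b)
  , subst (λ B → ¬ HasInternalOcc A (B ++ A)) (φ^-b n) (φ^-pair-noInternal n b a)
  , φ^-abaa n
  , countOcc-φ^ n (a ∷ b ∷ a ∷ a ∷ []) )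
  where
  A = φ^ n [ a ]
  Claim : Str → Str → Set
  Claim U W = ¬ HasInternalOcc U (U ++ U) × ¬ HasInternalOcc U (U ++ hat U)
    × ¬ HasInternalOcc U (hat U ++ U) × W ≡ U ++ hat U ++ U ++ U × countOcc U W ≡ 3
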